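{- Let $G$ be a graph on $n$ vertices, $k$ a positive integer, and let $T$ be a partial monotone search strategy with $k$ searchers for $G$. Then $T$ has at most $n^2+1$ nodes.
   Context: For $X\subseteq V(G)$, an $X$-flap is the vertex set of a connected component of $G-X$. A position is a pair $(X,R)$ with $X\subseteq V(G)$ and $R$ a union of (zero or more) $X$-flaps. A partial monotone search strategy (partial MSS) with $k$ searchers is a directed tree $T=(\mathcal{P},F)$ whose nodes $\mathcal{P}$ are positions with $|X|\leq k$ for all $(X,R)\in\mathcal{P}$, such that (i) the root is $(\emptyset,V(G))$, and (iii) for every non-leaf $(X,R)$ we have $R\ne\emptyset$ and there is $X'\subseteq X\cup R$ such that exactly one of: (a) $X'\subsetneq X$ and $(X',R)$ is the unique out-neighbour; (b) $X'\supsetneq X$ and $(X',R\setminus X')$ is the unique out-neighbour; (c) $X'=X$ and the out-neighbours are $(X,R_1),\dots,(X,R_t)$ with $t\geq 2$ where $R_1,\dots,R_t$ are the $X$-flaps contained in $R$. (The root is not considered a leaf even if it has degree 1.) -}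

module Defs where

open import Data.Nat using (ℕ; _≤_)
open import Data.Fin using (Fin)
open import Data.Fin.Subset using (Subset; _∈_; _∉_; _⊆_; _⊂_; _⊃_; _∪_; _─_; ∁; ∣_∣; Nonempty; ⊥; ⊤)
open import Data.Product using (Σ; ∃; _×_; _,_)
open import Data.Sum using (_⊎_)
open import Relation.Binary.PropositionalEquality using (_≡_; _≢_)
open import Relation.Nullary using (¬_)
open import Function.Definitions using (Injective)

record Graph (n : ℕ) : Set₁ where
  field
    E     : Fin n → Fin n → Set
    sym   : ∀ {u v} → E u v → E v u
    irrefl : ∀ {u} → ¬ E u u
open Graph public

module _ {n : ℕ} (G : Graph n) where

  data WalkIn (S : Subset n) : Fin n → Fin n → Set where
    here : ∀ {u} → u ∈ S → WalkIn S u u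
    step : ∀ {u w v} → u ∈ S → E G u w → WalkIn S w v → WalkIn S u v

  record IsFlap (X C : Subset n) : Set where
    field
      nonempty  : Nonempty C
      avoids    : C ⊆ ∁ X
      connected : ∀ {u v} → u ∈ C → v ∈ C → WalkIn C u v
      maximal   : ∀ {u v} → u ∈ C → v ∉ X → E G u v → v ∈ C

  IsUnionOfFlaps : Subset n → Subset n → Set
  IsUnionOfFlaps X R = ∀ {v} → v ∈ R → ∃ λ C → IsFlap X C × v ∈ C × C ⊆ R

  Position : Set
  Position = Subset n × Subset n

  IsPosition : Position → Set
  IsPosition (X , R) = IsUnionOfFlaps X R

data DPath {m : ℕ} (F : Fin m → Fin m → Set) : Fin m → Fin m → Set where
  [] : ∀ {a} → DPath F a a
  _∷_ : ∀ {a b c} → F a b → DPath F b c → DPath F a c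

record IsDirectedTree {m : ℕ} (F : Fin m → Fin m → Set) (r : Fin m) : Set where
  field
    root-no-in   : ∀ {a} → ¬ F a r
    unique-in    : ∀ {b} → b ≢ r → Σ (Fin m) λ a → F a b × (∀ {a'} → F a' b → a' ≡ a)
    reachable    : ∀ b → DPath F r b

-- A partial monotone search strategy with k searchers for G.
-- Nodes are Fin m; pos labels each node by a position, injectively
-- (the node set of T is a set of positions); F is the edge relation.
record PartialMSS {n : ℕ} (G : Graph n) (k : ℕ) (m : ℕ) : Set₁ where
  field
    pos        : Fin m → Position G
    pos-inj    : Injective _≡_ _≡_ pos
    F          : Fin m → Fin m → Set
    root       : Fin m
    tree       : IsDirectedTree F root
    positions  : ∀ a → IsPosition G (pos a)
    searchers  : ∀ a → let (X , R) = pos a in ∣ X ∣ ≤ k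
    root-pos   : pos root ≡ (⊥ , ⊤)

  IsNonLeaf : Fin m → Set
  IsNonLeaf a = a ≡ root ⊎ (∃ λ b → F a b)

  UniqueOut : Fin m → Position G → Set
  UniqueOut a p = Σ (Fin m) λ b → F a b × pos b ≡ p × (∀ {c} → F a c → c ≡ b)

  BranchOut : Fin m → Subset n → Subset n → Set
  BranchOut a X R =
      (∀ {c} → F a c → ∃ λ C → IsFlap G X C × C ⊆ R × pos c ≡ (X , C))
    × (∀ C → IsFlap G X C → C ⊆ R → Σ (Fin m) λ c → F a c × pos c ≡ (X , C))
    × (Σ (Fin m) λ c₁ → Σ (Fin m) λ c₂ → F a c₁ × F a c₂ × c₁ ≢ c₂)

  NonLeafCondition : Fin m → Set
  NonLeafCondition a =
    let (X , R) = pos a in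
    Nonempty R ×
    (∃ λ X' → X' ⊆ X ∪ R ×
        ( (X' ⊂ X × UniqueOut a (X' , R))
        ⊎ (X' ⊃ X × UniqueOut a (X' , R ─ X'))
        ⊎ (X' ≡ X × BranchOut a X R)))

  field
    non-leaf   : ∀ a → IsNonLeaf a → NonLeafCondition a

module Submission where

-- Give a position (X , R) the potential |R| (|R| + |X|).  Along every edge of a search
-- strategy the potential drops: removing searchers (case a) shrinks |X| with R ≠ ∅, placing
-- searchers (case b) strictly shrinks R without increasing |R| + |X|, and in a split (case c)
-- the children are pairwise distinct flaps C ⊂ R, so their potentials are each below
-- |C| (|R| + |X|) and add up to less than |R| (|R| + |X|).  Hence every node weighs (potential
-- plus one) more than all its children together, and counting each node once at its parent
-- bounds the number of nodes by the weight n² + 1 of the root (∅ , V(G)).  Neither k nor the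
-- positivity of k plays any role.

open import Defs hiding (sym)
open import Data.Nat using (ℕ; zero; suc; _≤_; _<_; _>_; _+_; _*_; z≤n; s≤s; >-nonZero)
open import Data.Nat.Properties
  using (+-*-semiring; ≤-refl; ≤-reflexive; ≤-trans; <-≤-trans; m≤m+n; m<n⇒0<n; +-comm; +-suc;
         +-identityʳ; +-cancelʳ-≤; +-mono-≤; +-monoʳ-≤; +-monoʳ-<; +-monoˡ-<; *-monoʳ-≤; *-monoˡ-≤;
         *-monoʳ-<; *-monoˡ-<; module ≤-Reasoning)
open import Algebra.Properties.Semiring.Sum +-*-semiring
  using (sum; sum-syntax; ∑-comm; ∑-distrib-+; *-distribʳ-sum; sum-cong-≗; sum-replicate-zero)
open import Data.Bool using (true; false; not; _∧_; if_then_else_)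
open import Data.Fin using (Fin; zero; suc; _≟_)
open import Data.Fin.Properties using (any?; 0≢1+n; suc-injective)
open import Data.Fin.Subset using (Subset; inside; outside; _∈_; _⊆_; _⊂_; _∪_; _─_; ∁; ∣_∣; ⊥; Nonempty)
open import Data.Fin.Subset.Properties
  using (⊆-antisym; ⊥⊆; ∉⊥; x∈∁p⇒x∉p; x∈p∪q⁻; p⊆p∪q; q⊆p∪q; x∈p∧x∉q⇒x∈p─q; x∈p∩q⁺; ∣p─q∣≤∣p∣;
         p∩q≢∅⇒∣p─q∣<∣p∣; p⊆q⇒∣p∣≤∣q∣; p⊂q⇒∣p∣<∣q∣; ∣⊤∣≡n; ∣⊥∣≡0)
open import Data.Vec using (_∷_; [])
open import Data.Product using (∃; _×_; _,_; proj₁; proj₂)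
open import Data.Sum using (inj₁; inj₂; [_,_]′)
open import Data.Empty using (⊥-elim)
open import Function using (_∘_)
open import Relation.Binary.PropositionalEquality
  using (_≡_; _≢_; refl; sym; trans; cong; cong₂; subst; module ≡-Reasoning)
open import Relation.Nullary using (¬_; Dec; yes; no; does; ¬?; _×-dec_)
open import Relation.Nullary.Decidable using (dec-true; dec-false)

sum-mono-≤ : ∀ {m} {f g : Fin m → ℕ} → (∀ i → f i ≤ g i) → sum f ≤ sum g
sum-mono-≤ {zero}  f≤g = z≤n
sum-mono-≤ {suc m} f≤g = +-mono-≤ (f≤g zero) (sum-mono-≤ (f≤g ∘ suc))

sum-zero : ∀ {m} {f : Fin m → ℕ} → (∀ i → f i ≡ 0) → sum f ≡ 0
sum-zero {m} f≡0 = trans (sum-cong-≗ f≡0) (sum-replicate-zero m)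

sum-ones : ∀ m → ∑[ i < m ] 1 ≡ m
sum-ones zero    = refl
sum-ones (suc m) = cong suc (sum-ones m)

sum-supported : ∀ {m} (f : Fin m → ℕ) j → (∀ i → i ≢ j → f i ≡ 0) → sum f ≡ f j
sum-supported f zero    f≡0 = trans (cong (f zero +_) (sum-zero (λ i → f≡0 (suc i) λ ()))) (+-identityʳ _)
sum-supported f (suc j) f≡0 rewrite f≡0 zero (λ ()) =
  sum-supported (f ∘ suc) j (λ i i≢j → f≡0 (suc i) (i≢j ∘ suc-injective))

sum-indicator : ∀ {m} (j : Fin m) x → ∑[ i < m ] (if does (j ≟ i) then x else 0) ≡ x
sum-indicator j x = trans (sum-supported _ j off-j) (cong (if_then x else 0) (dec-true (j ≟ j) refl))
  where
  off-j : ∀ i → i ≢ j → (if does (j ≟ i) then x else 0) ≡ 0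
  off-j i i≢j rewrite dec-false (j ≟ i) (i≢j ∘ sym) = refl

if-0-≤ : ∀ b x → (if b then x else 0) ≤ x
if-0-≤ true  x = ≤-refl
if-0-≤ false x = z≤n

∪-⊆ : ∀ {n} {p q r : Subset n} → p ⊆ r → q ⊆ r → p ∪ q ⊆ r
∪-⊆ {p = p} {q} p⊆r q⊆r = [ p⊆r , q⊆r ]′ ∘ x∈p∪q⁻ p q

∣p─q∣+∣q∣≡∣p∪q∣ : ∀ {n} (p q : Subset n) → ∣ p ─ q ∣ + ∣ q ∣ ≡ ∣ p ∪ q ∣
∣p─q∣+∣q∣≡∣p∪q∣ []            []            = refl
∣p─q∣+∣q∣≡∣p∪q∣ (inside  ∷ p) (inside  ∷ q) = trans (+-suc _ _) (cong suc (∣p─q∣+∣q∣≡∣p∪q∣ p q))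
∣p─q∣+∣q∣≡∣p∪q∣ (outside ∷ p) (inside  ∷ q) = trans (+-suc _ _) (cong suc (∣p─q∣+∣q∣≡∣p∪q∣ p q))
∣p─q∣+∣q∣≡∣p∪q∣ (inside  ∷ p) (outside ∷ q) = cong suc (∣p─q∣+∣q∣≡∣p∪q∣ p q)
∣p─q∣+∣q∣≡∣p∪q∣ (outside ∷ p) (outside ∷ q) = ∣p─q∣+∣q∣≡∣p∪q∣ p q

∣p∪q∣≤∣p∣+∣q∣ : ∀ {n} (p q : Subset n) → ∣ p ∪ q ∣ ≤ ∣ p ∣ + ∣ q ∣
∣p∪q∣≤∣p∣+∣q∣ p q = subst (_≤ ∣ p ∣ + ∣ q ∣) (∣p─q∣+∣q∣≡∣p∪q∣ p q) (+-mono-≤ (∣p─q∣≤∣p∣ p q) ≤-refl)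

Nonempty⇒∣p∣>0 : ∀ {n} {p : Subset n} → Nonempty p → ∣ p ∣ > 0
Nonempty⇒∣p∣>0 {n} {p} (x , x∈p) = subst (_< ∣ p ∣) (∣⊥∣≡0 n) (p⊂q⇒∣p∣<∣q∣ (⊥⊆ , x , x∈p , ∉⊥))

sum-∣disjoint∣≤ : ∀ {m n} (A : Fin m → Subset n) {R : Subset n} → (∀ i → A i ⊆ R) →
                  (∀ {i j v} → v ∈ A i → v ∈ A j → i ≡ j) → ∑[ i < m ] ∣ A i ∣ ≤ ∣ R ∣
sum-∣disjoint∣≤ {zero}  A A⊆R disjoint = z≤n
sum-∣disjoint∣≤ {suc m} A {R} A⊆R disjoint = begin
  ∣ A zero ∣ + ∑[ i < m ] ∣ A (suc i) ∣ ≤⟨ +-monoʳ-≤ ∣ A zero ∣ (sum-∣disjoint∣≤ (A ∘ suc) rest⊆R─A₀ rest-disjoint) ⟩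
  ∣ A zero ∣ + ∣ R ─ A zero ∣          ≡⟨ +-comm ∣ A zero ∣ _ ⟩
  ∣ R ─ A zero ∣ + ∣ A zero ∣          ≡⟨ ∣p─q∣+∣q∣≡∣p∪q∣ R (A zero) ⟩
  ∣ R ∪ A zero ∣                       ≤⟨ p⊆q⇒∣p∣≤∣q∣ (∪-⊆ (λ v∈R → v∈R) (A⊆R zero)) ⟩
  ∣ R ∣                                ∎
  where
  open ≤-Reasoning
  rest⊆R─A₀ : ∀ i → A (suc i) ⊆ R ─ A zero
  rest⊆R─A₀ i v∈Aᵢ = x∈p∧x∉q⇒x∈p─q (A⊆R (suc i) v∈Aᵢ) (0≢1+n ∘ sym ∘ disjoint v∈Aᵢ)
  rest-disjoint : ∀ {i j v} → v ∈ A (suc i) → v ∈ A (suc j) → i ≡ j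
  rest-disjoint v∈Aᵢ v∈Aⱼ = suc-injective (disjoint v∈Aᵢ v∈Aⱼ)

potential : ∀ {n} → Subset n × Subset n → ℕ
potential (X , R) = ∣ R ∣ * (∣ R ∣ + ∣ X ∣)

module _ {n : ℕ} {X R : Subset n} where

  potential-remove : ∀ {X'} → Nonempty R → X' ⊂ X → potential (X' , R) < potential (X , R)
  potential-remove R≢∅ X'⊂X =
    *-monoʳ-< ∣ R ∣ {{>-nonZero (Nonempty⇒∣p∣>0 R≢∅)}} (+-monoʳ-< ∣ R ∣ (p⊂q⇒∣p∣<∣q∣ X'⊂X))

  potential-place : ∀ {X'} → X' ⊆ X ∪ R → X ⊂ X' → potential (X' , R ─ X') < potential (X , R)
  potential-place {X'} X'⊆X∪R (_ , v , v∈X' , v∉X) = begin-strict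
    ∣ R ─ X' ∣ * (∣ R ─ X' ∣ + ∣ X' ∣) ≤⟨ *-monoʳ-≤ ∣ R ─ X' ∣ size≤ ⟩
    ∣ R ─ X' ∣ * (∣ R ∣ + ∣ X ∣)       <⟨ *-monoˡ-< (∣ R ∣ + ∣ X ∣) {{>-nonZero R+X>0}} ∣R─X'∣<∣R∣ ⟩
    ∣ R ∣ * (∣ R ∣ + ∣ X ∣)            ∎
    where
    open ≤-Reasoning
    v∈R : v ∈ R
    v∈R = [ (λ v∈X → ⊥-elim (v∉X v∈X)) , (λ v∈R → v∈R) ]′ (x∈p∪q⁻ X R (X'⊆X∪R v∈X'))
    ∣R─X'∣<∣R∣ : ∣ R ─ X' ∣ < ∣ R ∣
    ∣R─X'∣<∣R∣ = p∩q≢∅⇒∣p─q∣<∣p∣ R X' (v , x∈p∩q⁺ (v∈R , v∈X'))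
    R+X>0 : ∣ R ∣ + ∣ X ∣ > 0
    R+X>0 = <-≤-trans (m<n⇒0<n ∣R─X'∣<∣R∣) (m≤m+n ∣ R ∣ ∣ X ∣)
    size≤ : ∣ R ─ X' ∣ + ∣ X' ∣ ≤ ∣ R ∣ + ∣ X ∣
    size≤ = begin
      ∣ R ─ X' ∣ + ∣ X' ∣ ≡⟨ ∣p─q∣+∣q∣≡∣p∪q∣ R X' ⟩
      ∣ R ∪ X' ∣          ≤⟨ p⊆q⇒∣p∣≤∣q∣ (∪-⊆ (p⊆p∪q X) (∪-⊆ (q⊆p∪q R X) (p⊆p∪q X) ∘ X'⊆X∪R)) ⟩
      ∣ R ∪ X ∣           ≤⟨ ∣p∪q∣≤∣p∣+∣q∣ R X ⟩
      ∣ R ∣ + ∣ X ∣       ∎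

  potential-split : ∀ {C} → Nonempty C → C ⊂ R → potential (X , C) < ∣ C ∣ * (∣ R ∣ + ∣ X ∣)
  potential-split {C} C≢∅ C⊂R =
    *-monoʳ-< ∣ C ∣ {{>-nonZero (Nonempty⇒∣p∣>0 C≢∅)}} (+-monoˡ-< ∣ X ∣ (p⊂q⇒∣p∣<∣q∣ C⊂R))

module _ {n : ℕ} (G : Graph n) where

  flap-closed-under-walks : ∀ {X C D u v} → C ⊆ ∁ X → IsFlap G X D → WalkIn G C u v → u ∈ D → v ∈ D
  flap-closed-under-walks C⊆∁X D-flap (here _) u∈D = u∈D
  flap-closed-under-walks C⊆∁X D-flap (step _ uw rest) u∈D =
    flap-closed-under-walks C⊆∁X D-flap rest
      (IsFlap.maximal D-flap u∈D (x∈∁p⇒x∉p (C⊆∁X (start rest))) uw)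
    where
    start : ∀ {S a b} → WalkIn G S a b → a ∈ S
    start (here a∈S)     = a∈S
    start (step a∈S _ _) = a∈S

  flap-≡ : ∀ {X C D v} → IsFlap G X C → IsFlap G X D → v ∈ C → v ∈ D → C ≡ D
  flap-≡ C-flap D-flap v∈C v∈D = ⊆-antisym (C⊆ C-flap D-flap v∈C v∈D) (C⊆ D-flap C-flap v∈D v∈C)
    where
    C⊆ : ∀ {X C D v} → IsFlap G X C → IsFlap G X D → v ∈ C → v ∈ D → C ⊆ D
    C⊆ C-flap D-flap v∈C v∈D u∈C =
      flap-closed-under-walks (IsFlap.avoids C-flap) D-flap (IsFlap.connected C-flap v∈C u∈C) v∈D

module ParentCounting {m : ℕ} (root : Fin m) (parent : Fin m → Fin m) where

  Child : Fin m → Fin m → Set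
  Child a b = b ≢ root × parent b ≡ a

  child? : ∀ a b → Dec (Child a b)
  child? a b = ¬? (b ≟ root) ×-dec parent b ≟ a

  childTerm : (Fin m → ℕ) → Fin m → Fin m → ℕ
  childTerm w a b = if does (child? a b) then w b else 0

  childSum : (Fin m → ℕ) → Fin m → ℕ
  childSum w a = ∑[ b < m ] childTerm w a b

  childTerm-yes : ∀ w {a b} → Child a b → childTerm w a b ≡ w b
  childTerm-yes w {a} {b} a→b = cong (if_then w b else 0) (dec-true (child? a b) a→b)

  childTerm-no : ∀ w {a b} → ¬ Child a b → childTerm w a b ≡ 0
  childTerm-no w {a} {b} a↛b = cong (if_then w b else 0) (dec-false (child? a b) a↛b)

  module _ (w : Fin m → ℕ) where

    private
      atRoot : Fin m → ℕ
      atRoot b = if does (b ≟ root) then w b else 0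

      -- The decision b ≟ root is a parameter so that it can be split on: in the goals it
      -- occurs only inside the unfolded child? a b.
      parents+atRoot : ∀ b (b≟root : Dec (b ≡ root)) →
        ∑[ a < m ] (if not (does b≟root) ∧ does (parent b ≟ a) then w b else 0)
          + (if does b≟root then w b else 0) ≡ w b
      parents+atRoot b (yes _) = cong (_+ w b) (sum-zero {m} (λ _ → refl))
      parents+atRoot b (no _)  = trans (cong (_+ 0) (sum-indicator (parent b) (w b))) (+-identityʳ (w b))

    sum-childSum : ∑[ a < m ] childSum w a + w root ≡ sum w
    sum-childSum = begin
      ∑[ a < m ] ∑[ b < m ] h a b + w root     ≡⟨ cong₂ _+_ (∑-comm h) (sym sum-atRoot) ⟩
      ∑[ b < m ] ∑[ a < m ] h a b + sum atRoot  ≡⟨ sym (∑-distrib-+ (λ b → ∑[ a < m ] h a b) atRoot) ⟩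
      ∑[ b < m ] (∑[ a < m ] h a b + atRoot b)  ≡⟨ sum-cong-≗ (λ b → parents+atRoot b (b ≟ root)) ⟩
      sum w                                     ∎
      where
      open ≡-Reasoning
      h : Fin m → Fin m → ℕ
      h = childTerm w
      sum-atRoot : sum atRoot ≡ w root
      sum-atRoot = trans (sum-supported atRoot root off-root) at-root
        where
        off-root : ∀ b → b ≢ root → atRoot b ≡ 0
        off-root b b≢root rewrite dec-false (b ≟ root) b≢root = refl
        at-root : atRoot root ≡ w root
        at-root rewrite dec-true (root ≟ root) refl = refl

    m≤root-weight : (∀ a → childSum w a < w a) → m ≤ w root
    m≤root-weight childSum<w = +-cancelʳ-≤ (∑[ a < m ] childSum w a) m (w root) (begin
      m + ∑[ a < m ] childSum w a              ≡⟨ cong (_+ ∑[ a < m ] childSum w a) (sym (sum-ones m)) ⟩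
      ∑[ a < m ] 1 + ∑[ a < m ] childSum w a   ≡⟨ sym (∑-distrib-+ (λ _ → 1) (childSum w)) ⟩
      ∑[ a < m ] suc (childSum w a)            ≤⟨ sum-mono-≤ childSum<w ⟩
      sum w                                    ≡⟨ sym sum-childSum ⟩
      ∑[ a < m ] childSum w a + w root         ≡⟨ +-comm _ (w root) ⟩
      w root + ∑[ a < m ] childSum w a         ∎)
      where open ≤-Reasoning

module SearchTree {n k m : ℕ} {G : Graph n} (T : PartialMSS G k m) where

  open PartialMSS T
  open IsDirectedTree tree

  -- The root has no parent; the value root there is junk that Child never looks at.
  parent : Fin m → Fin m
  parent b with b ≟ root
  ... | yes _     = root
  ... | no b≢root = proj₁ (unique-in b≢root)

  open ParentCounting root parent

  child⇒edge : ∀ {a b} → Child a b → F a b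
  child⇒edge {b = b} (b≢root , refl) with b ≟ root
  ... | yes b≡root = ⊥-elim (b≢root b≡root)
  ... | no b≢root' = proj₁ (proj₂ (unique-in b≢root'))

  weight : Fin m → ℕ
  weight a = suc (potential (pos a))

  childSum-unique-out : ∀ {a p} → UniqueOut a p → childSum weight a ≤ suc (potential p)
  childSum-unique-out {a} {p} (b , _ , pos-b , unique) = begin
    childSum weight a        ≡⟨ sum-supported _ b (λ c c≢b → childTerm-no weight (c≢b ∘ unique ∘ child⇒edge)) ⟩
    childTerm weight a b     ≤⟨ if-0-≤ (does (child? a b)) (weight b) ⟩
    weight b                 ≡⟨ cong (λ q → suc (potential q)) pos-b ⟩
    suc (potential p)        ∎
    where open ≤-Reasoning

  module Branching {a : Fin m} (branch : BranchOut a (proj₁ (pos a)) (proj₂ (pos a))) where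

    X R : Subset n
    X = proj₁ (pos a)
    R = proj₂ (pos a)

    region : Fin m → Subset n
    region c = proj₂ (pos c)

    out-flap : ∀ {c} → F a c → proj₁ (pos c) ≡ X × IsFlap G X (region c) × region c ⊆ R
    out-flap a→c with proj₁ branch a→c
    ... | C , C-flap , C⊆R , pos-c rewrite pos-c = refl , C-flap , C⊆R

    out-meeting-≡ : ∀ {c c' v} → F a c → F a c' → v ∈ region c → v ∈ region c' → c ≡ c'
    out-meeting-≡ a→c a→c' v∈c v∈c' with out-flap a→c | out-flap a→c'
    ... | X-c , c-flap , _ | X-c' , c'-flap , _ =
      pos-inj (cong₂ _,_ (trans X-c (sym X-c')) (flap-≡ G c-flap c'-flap v∈c v∈c'))

    another-out : ∀ c → ∃ λ c' → F a c' × c' ≢ c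
    another-out c with proj₂ (proj₂ branch)
    ... | c₁ , c₂ , a→c₁ , a→c₂ , c₁≢c₂ with c ≟ c₁
    ...   | yes refl = c₂ , a→c₂ , c₁≢c₂ ∘ sym
    ...   | no c≢c₁  = c₁ , a→c₁ , c≢c₁ ∘ sym

    out-⊂ : ∀ {c} → F a c → region c ⊂ R
    out-⊂ {c} a→c with another-out c
    ... | c' , a→c' , c'≢c with out-flap a→c'
    ...   | _ , c'-flap , c'⊆R with IsFlap.nonempty c'-flap
    ...     | v , v∈c' = proj₂ (proj₂ (out-flap a→c)) , v , c'⊆R v∈c' ,
                         λ v∈c → c'≢c (out-meeting-≡ a→c' a→c v∈c' v∈c)

    childRegion : Fin m → Subset n
    childRegion c with child? a c
    ... | yes _ = region c
    ... | no _  = ⊥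

    childRegion⊆R : ∀ c → childRegion c ⊆ R
    childRegion⊆R c with child? a c
    ... | yes a→c = proj₂ (proj₂ (out-flap (child⇒edge a→c)))
    ... | no _    = ⊥⊆

    childRegion-disjoint : ∀ {c c' v} → v ∈ childRegion c → v ∈ childRegion c' → c ≡ c'
    childRegion-disjoint {c} {c'} v∈c v∈c' with child? a c | child? a c'
    ... | yes a→c | yes a→c' = out-meeting-≡ (child⇒edge a→c) (child⇒edge a→c') v∈c v∈c'
    ... | no _    | _        = ⊥-elim (∉⊥ v∈c)
    ... | yes _   | no _     = ⊥-elim (∉⊥ v∈c')

    childTerm≤ : ∀ c → childTerm weight a c ≤ ∣ childRegion c ∣ * (∣ R ∣ + ∣ X ∣)
    childTerm≤ c with child? a c
    ... | no a↛c  = ≤-trans (≤-reflexive (childTerm-no weight a↛c)) z≤n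
    ... | yes a→c with out-flap (child⇒edge a→c)
    ...   | X-c , c-flap , _ = begin
      childTerm weight a c            ≡⟨ childTerm-yes weight a→c ⟩
      suc (potential (pos c))         ≡⟨ cong (λ Y → suc (potential (Y , region c))) X-c ⟩
      suc (potential (X , region c))  ≤⟨ potential-split {X = X} (IsFlap.nonempty c-flap) (out-⊂ (child⇒edge a→c)) ⟩
      ∣ region c ∣ * (∣ R ∣ + ∣ X ∣)  ∎
      where open ≤-Reasoning

    ∑∣childRegion∣≤∣R∣ : ∑[ c < m ] ∣ childRegion c ∣ ≤ ∣ R ∣
    ∑∣childRegion∣≤∣R∣ = sum-∣disjoint∣≤ childRegion childRegion⊆R childRegion-disjoint

    childSum≤potential : childSum weight a ≤ potential (pos a)
    childSum≤potential = begin
      childSum weight a                                 ≤⟨ sum-mono-≤ childTerm≤ ⟩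
      ∑[ c < m ] (∣ childRegion c ∣ * (∣ R ∣ + ∣ X ∣))  ≡⟨ sym (*-distribʳ-sum (∣ R ∣ + ∣ X ∣) (∣_∣ ∘ childRegion)) ⟩
      (∑[ c < m ] ∣ childRegion c ∣) * (∣ R ∣ + ∣ X ∣)  ≤⟨ *-monoˡ-≤ (∣ R ∣ + ∣ X ∣) ∑∣childRegion∣≤∣R∣ ⟩
      ∣ R ∣ * (∣ R ∣ + ∣ X ∣)                           ∎
      where open ≤-Reasoning

  childSum<weight : ∀ a → childSum weight a < weight a
  childSum<weight a with any? (child? a)
  ... | no childless = s≤s (≤-trans (≤-reflexive (sum-zero (λ c → childTerm-no weight (childless ∘ (c ,_))))) z≤n)
  ... | yes (c , a→c) with non-leaf a (inj₂ (c , child⇒edge a→c))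
  ...   | R≢∅ , _ , _ , inj₁ (X'⊂X , out) =
          s≤s (≤-trans (childSum-unique-out out) (potential-remove R≢∅ X'⊂X))
  ...   | _ , _ , X'⊆X∪R , inj₂ (inj₁ (X⊂X' , out)) =
          s≤s (≤-trans (childSum-unique-out out) (potential-place X'⊆X∪R X⊂X'))
  ...   | _ , _ , _ , inj₂ (inj₂ (_ , branch)) = s≤s (Branching.childSum≤potential branch)

  m≤n*n+1 : m ≤ n * n + 1
  m≤n*n+1 = subst (m ≤_) root-weight (m≤root-weight weight childSum<weight)
    where
    root-weight : weight root ≡ n * n + 1
    root-weight rewrite root-pos | ∣⊤∣≡n n | ∣⊥∣≡0 n | +-identityʳ n = +-comm 1 (n * n)

lemma5 : ∀ {n} (G : Graph n) (k : ℕ) → k > 0 → ∀ m → PartialMSS G k m → m ≤ n * n + 1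
lemma5 G k _ m T = SearchTree.m≤n*n+1 T
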